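{- Let $k$ be a field of characteristic zero and let $(A,0,P)$ be a Rota-Baxter algebra of weight $\lambda=0$ over $k$, i.e. $A$ is an associative $k$-algebra and $P:A\to A$ is a $k$-linear map with $P(x)P(y)=P(xP(y))+P(P(x)y)$ for all $x,y\in A$. For integers $a,b,c\ge 0$ let $T(a,b,c):A\otimes A\to A$ be the operator $T(a,b,c)(x\otimes y)=P^{c}\big(P^{a}(x)\,P^{b}(y)\big)$, where $P^0$ is the identity. Then for all integers $a,b>1$ and $c\ge 0$, \[T(a,b,c)=\sum_{i=1}^{b}\binom{a-1+b-i}{a-1}T(0,i,a+b+c-i)+\sum_{i=1}^{a}\binom{b-1+a-i}{b-1}T(i,0,a+b+c-i).\]
   Context: A Rota-Baxter algebra is a triple $(A,\lambda,P)$ with $A$ an associative $k$-algebra, $\lambda\in k$, and $P:A\to A$ a $k$-linear operator satisfying $P(x)P(y)=P(xP(y))+P(P(x)y)+\lambda P(xy)$ for all $x,y\in A$. -}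

module Defs where

open import Level using (Level; _⊔_) renaming (suc to lsuc)
open import Data.Nat using (ℕ; zero; suc; _+_; _∸_)
open import Data.Nat.Combinatorics using (_C_)
open import Data.Product using (∃)
open import Relation.Nullary using (¬_)
open import Algebra.Bundles using (CommutativeRing; Ring)
open import Algebra.Structures using (IsRing)
open import Algebra.Module.Bundles using (Module)
import Algebra.Definitions.RawMonoid as RawMonoidDefs

record Field (c ℓ : Level) : Set (lsuc (c ⊔ ℓ)) where
  field
    commutativeRing : CommutativeRing c ℓ
  open CommutativeRing commutativeRing public
  field
    1≉0     : ¬ (1# ≈ 0#)
    inverse : ∀ x → ¬ (x ≈ 0#) → ∃ λ y → (x * y) ≈ 1#

CharacteristicZero : ∀ {c ℓ} → Field c ℓ → Set ℓ
CharacteristicZero K = ∀ n → ¬ ((suc n × 1#) ≈ 0#)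
  where
  open Field K
  open RawMonoidDefs +-rawMonoid using (_×_)

record KAlgebra {c ℓ : Level} (K : Field c ℓ) (a ℓa : Level)
       : Set (c ⊔ ℓ ⊔ lsuc (a ⊔ ℓa)) where
  open Field K using (commutativeRing) renaming (Carrier to k)
  field
    module′ : Module commutativeRing a ℓa
  open Module module′ public
  infixl 7 _*_
  field
    _*_  : Carrierᴹ → Carrierᴹ → Carrierᴹ
    1A   : Carrierᴹ
    isRing : IsRing _≈ᴹ_ _+ᴹ_ _*_ -ᴹ_ 0ᴹ 1A
    *-scalarˡ : ∀ (r : k) x y → ((r *ₗ x) * y) ≈ᴹ (r *ₗ (x * y))
    *-scalarʳ : ∀ (r : k) x y → (x * (r *ₗ y)) ≈ᴹ (r *ₗ (x * y))

  ringA : Ring a ℓa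
  ringA = record { isRing = isRing }

  open RawMonoidDefs (Ring.+-rawMonoid ringA) public using (_×_)

module _ {c ℓ a ℓa : Level} {K : Field c ℓ} (A : KAlgebra K a ℓa) where
  open Field K using () renaming (Carrier to k)
  open KAlgebra A

  record IsLinear (P : Carrierᴹ → Carrierᴹ) : Set (c ⊔ a ⊔ ℓa) where
    field
      cong  : ∀ {x y} → x ≈ᴹ y → P x ≈ᴹ P y
      +-hom : ∀ x y → P (x +ᴹ y) ≈ᴹ (P x +ᴹ P y)
      *ₗ-hom : ∀ (r : k) x → P (r *ₗ x) ≈ᴹ (r *ₗ P x)

  record IsRotaBaxter (λ′ : k) (P : Carrierᴹ → Carrierᴹ) : Set (c ⊔ a ⊔ ℓa) where
    field
      linear : IsLinear P
      rb     : ∀ x y →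
        (P x * P y) ≈ᴹ ((P (x * P y) +ᴹ P (P x * y)) +ᴹ (λ′ *ₗ P (x * y)))

  iter : ℕ → (Carrierᴹ → Carrierᴹ) → Carrierᴹ → Carrierᴹ
  iter zero    P x = x
  iter (suc n) P x = P (iter n P x)

  -- T(a,b,c)(x ⊗ y) = P^c (P^a(x) P^b(y)), evaluated on pure tensors
  T : (Carrierᴹ → Carrierᴹ) → ℕ → ℕ → ℕ → Carrierᴹ → Carrierᴹ → Carrierᴹ
  T P i j l x y = iter l P (iter i P x * iter j P y)

  sum1 : ℕ → (ℕ → Carrierᴹ) → Carrierᴹ
  sum1 zero    f = 0ᴹ
  sum1 (suc n) f = sum1 n f +ᴹ f (suc n)

{-# OPTIONS --safe #-}
module Submission where

-- For a Rota-Baxter operator of weight 0, expanding P(u)P(v) by the Rota-Baxter identity gives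
-- T(m+1, n+1, l) = T(m, n+1, l+1) + T(m+1, n, l+1), a Pascal recursion in (m, n).  Unrolling it
-- until one exponent reaches 0, the coefficient of T(0, i, ·) counts the lattice paths from
-- (m, n) to (0, i) whose last step lowers the first coordinate, which is the multiset coefficient
-- ((m multichoose n − i)) = C(m − 1 + n − i, m − 1).  Phrased with multiset coefficients, which
-- also make sense for m = 0, the expansion holds for every (m, n) ≠ (0, 0) and is proved by
-- induction along the recursion.

open import Defs
open import Level using (Level)
open import Data.Nat using (ℕ; zero; suc; _+_; _∸_; _≤_; _<_; s≤s; z<s)
open import Data.Nat.Properties
  using ( +-identityʳ; +-suc; +-∸-assoc; n∸n≡0; m+n∸m≡n
        ; ≤-refl; m≤n⇒m≤1+n; m≤n+m; <-≤-trans)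
open import Data.Nat.Combinatorics using (_C_; nCn≡1; nCk+nC[k+1]≡[n+1]C[k+1])
open import Relation.Binary.PropositionalEquality
  using (_≡_; refl; sym; trans; cong; cong₂; subst; module ≡-Reasoning)
open import Algebra.Bundles using (Ring)
import Algebra.Properties.Monoid.Mult as Mult
import Algebra.Properties.CommutativeSemigroup as CommutativeSemigroupProperties
import Relation.Binary.Reasoning.Setoid as SetoidReasoning

multichoose : ℕ → ℕ → ℕ
multichoose _       zero    = 1
multichoose zero    (suc j) = 0
multichoose (suc m) (suc j) = multichoose m (suc j) + multichoose (suc m) j

multichoose-suc : ∀ m j → multichoose (suc m) j ≡ (m + j) C m
multichoose-suc m       zero    = sym (trans (cong (_C m) (+-identityʳ m)) (nCn≡1 m))
multichoose-suc zero    (suc j) = multichoose-suc zero j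
multichoose-suc (suc m) (suc j) = begin
  multichoose (suc m) (suc j) + multichoose (suc (suc m)) j
    ≡⟨ cong₂ _+_ (multichoose-suc m (suc j)) (multichoose-suc (suc m) j) ⟩
  (m + suc j) C m + suc (m + j) C suc m
    ≡⟨ cong (λ k → (m + suc j) C m + k C suc m) (sym (+-suc m j)) ⟩
  (m + suc j) C m + (m + suc j) C suc m
    ≡⟨ nCk+nC[k+1]≡[n+1]C[k+1] (m + suc j) m ⟩
  suc (m + suc j) C suc m ∎
  where open ≡-Reasoning

multichoose-pascal-below : ∀ m {n i} → i ≤ n →
  multichoose (suc m) (suc n ∸ i) ≡ multichoose m (suc n ∸ i) + multichoose (suc m) (n ∸ i)
multichoose-pascal-below m i≤n rewrite +-∸-assoc 1 i≤n = refl

multichoose-diagonal : ∀ m n → multichoose m (n ∸ n) ≡ 1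
multichoose-diagonal m n = cong (multichoose m) (n∸n≡0 n)

multichoose-zero-below : ∀ {n i} → i ≤ n → multichoose 0 (suc n ∸ i) ≡ 0
multichoose-zero-below i≤n rewrite +-∸-assoc 1 i≤n = refl

module _ {c ℓ a ℓa : Level} {K : Field c ℓ} (A : KAlgebra K a ℓa) where
  open KAlgebra A
  open Mult (Ring.+-monoid ringA) using (×-cong; ×-homo-1; ×-homo-+)
  open CommutativeSemigroupProperties (Ring.+-commutativeSemigroup ringA)
    using (interchange; xy∙z≈xz∙y)
  open SetoidReasoning ≈ᴹ-setoid

  sum1-cong : ∀ n {f g : ℕ → Carrierᴹ} → (∀ {i} → i ≤ n → f i ≈ᴹ g i) →
              sum1 A n f ≈ᴹ sum1 A n g
  sum1-cong zero    f≈g = ≈ᴹ-refl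
  sum1-cong (suc n) f≈g = +ᴹ-cong (sum1-cong n (λ i≤n → f≈g (m≤n⇒m≤1+n i≤n))) (f≈g ≤-refl)

  sum1-zero : ∀ n {f : ℕ → Carrierᴹ} → (∀ {i} → i ≤ n → f i ≈ᴹ 0ᴹ) →
              sum1 A n f ≈ᴹ 0ᴹ
  sum1-zero n f≈0 = ≈ᴹ-trans (sum1-cong n f≈0) (sum1-const-zero n)
    where
    sum1-const-zero : ∀ n → sum1 A n (λ _ → 0ᴹ) ≈ᴹ 0ᴹ
    sum1-const-zero zero    = ≈ᴹ-refl
    sum1-const-zero (suc n) = ≈ᴹ-trans (+ᴹ-identityʳ _) (sum1-const-zero n)

  sum1-+ : ∀ n (f g : ℕ → Carrierᴹ) →
           sum1 A n (λ i → f i +ᴹ g i) ≈ᴹ (sum1 A n f +ᴹ sum1 A n g)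
  sum1-+ zero    f g = ≈ᴹ-sym (+ᴹ-identityʳ 0ᴹ)
  sum1-+ (suc n) f g = ≈ᴹ-trans (+ᴹ-cong (sum1-+ n f g) ≈ᴹ-refl) (interchange _ _ _ _)

  multichooseSum : ℕ → ℕ → (ℕ → Carrierᴹ) → Carrierᴹ
  multichooseSum m n w = sum1 A n (λ i → multichoose m (n ∸ i) × w i)

  multichooseSum-zero : ∀ n w → multichooseSum 0 (suc n) w ≈ᴹ w (suc n)
  multichooseSum-zero n w = begin
    sum1 A n (λ i → multichoose 0 (suc n ∸ i) × w i) +ᴹ multichoose 0 (n ∸ n) × w (suc n)
      ≈⟨ +ᴹ-cong (sum1-zero n (λ i≤n → ×-cong (multichoose-zero-below i≤n) ≈ᴹ-refl))
                 (×-cong (multichoose-diagonal 0 n) ≈ᴹ-refl) ⟩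
    0ᴹ +ᴹ 1 × w (suc n)  ≈⟨ +ᴹ-identityˡ _ ⟩
    1 × w (suc n)        ≈⟨ ×-homo-1 _ ⟩
    w (suc n)            ∎

  multichooseSum-pascal : ∀ m n w →
    multichooseSum (suc m) (suc n) w ≈ᴹ (multichooseSum m (suc n) w +ᴹ multichooseSum (suc m) n w)
  multichooseSum-pascal m n w = begin
    sum1 A n (λ i → multichoose (suc m) (suc n ∸ i) × w i) +ᴹ multichoose (suc m) (n ∸ n) × w (suc n)
      ≈⟨ +ᴹ-cong (sum1-cong n split) (×-cong top ≈ᴹ-refl) ⟩
    sum1 A n (λ i → left i +ᴹ right i) +ᴹ multichoose m (n ∸ n) × w (suc n)
      ≈⟨ +ᴹ-cong (sum1-+ n left right) ≈ᴹ-refl ⟩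
    (sum1 A n left +ᴹ sum1 A n right) +ᴹ multichoose m (n ∸ n) × w (suc n)
      ≈⟨ xy∙z≈xz∙y _ _ _ ⟩
    (sum1 A n left +ᴹ multichoose m (n ∸ n) × w (suc n)) +ᴹ sum1 A n right ∎
    where
    left right : ℕ → Carrierᴹ
    left  i = multichoose m (suc n ∸ i) × w i
    right i = multichoose (suc m) (n ∸ i) × w i

    split : ∀ {i} → i ≤ n → multichoose (suc m) (suc n ∸ i) × w i ≈ᴹ (left i +ᴹ right i)
    split {i} i≤n = ≈ᴹ-trans (×-cong (multichoose-pascal-below m i≤n) ≈ᴹ-refl)
                             (×-homo-+ (w i) (multichoose m (suc n ∸ i)) _)

    top : multichoose (suc m) (n ∸ n) ≡ multichoose m (n ∸ n)
    top = trans (multichoose-diagonal (suc m) n) (sym (multichoose-diagonal m n))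

  multichooseSum-binomial : ∀ m n w →
    multichooseSum (suc m) n w ≈ᴹ sum1 A n (λ i → ((m + (n ∸ i)) C m) × w i)
  multichooseSum-binomial m n w =
    sum1-cong n (λ {i} _ → ×-cong (multichoose-suc m (n ∸ i)) ≈ᴹ-refl)

  module _ {P : Carrierᴹ → Carrierᴹ} (rbP : IsRotaBaxter A (Field.0# K) P) where
    open IsRotaBaxter rbP
    open IsLinear linear using (+-hom) renaming (cong to P-cong)

    iter-cong : ∀ l {u v} → u ≈ᴹ v → iter A l P u ≈ᴹ iter A l P v
    iter-cong zero    u≈v = u≈v
    iter-cong (suc l) u≈v = P-cong (iter-cong l u≈v)

    iter-+ : ∀ l u v → iter A l P (u +ᴹ v) ≈ᴹ (iter A l P u +ᴹ iter A l P v)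
    iter-+ zero    u v = ≈ᴹ-refl
    iter-+ (suc l) u v = ≈ᴹ-trans (P-cong (iter-+ l u v)) (+-hom _ _)

    iter-comm : ∀ l u → iter A l P (P u) ≡ P (iter A l P u)
    iter-comm zero    u = refl
    iter-comm (suc l) u = cong P (iter-comm l u)

    rb₀ : ∀ u v → (P u * P v) ≈ᴹ (P (u * P v) +ᴹ P (P u * v))
    rb₀ u v = ≈ᴹ-trans (rb u v) (≈ᴹ-trans (+ᴹ-cong ≈ᴹ-refl (*ₗ-zeroˡ _)) (+ᴹ-identityʳ _))

    T-pascal : ∀ m n l x y →
      T A P (suc m) (suc n) l x y ≈ᴹ (T A P m (suc n) (suc l) x y +ᴹ T A P (suc m) n (suc l) x y)
    T-pascal m n l x y = begin
      iter A l P (P u * P v)                                ≈⟨ iter-cong l (rb₀ u v) ⟩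
      iter A l P (P (u * P v) +ᴹ P (P u * v))               ≈⟨ iter-+ l _ _ ⟩
      iter A l P (P (u * P v)) +ᴹ iter A l P (P (P u * v))
        ≡⟨ cong₂ _+ᴹ_ (iter-comm l _) (iter-comm l _) ⟩
      T A P m (suc n) (suc l) x y +ᴹ T A P (suc m) n (suc l) x y ∎
      where
      u = iter A m P x
      v = iter A n P y

    module _ (x y : Carrierᴹ) where
      -- d stands for the total degree m + n + l; keeping it free lets both induction hypotheses
      -- of the Pascal step be stated at the same degree.
      Expansion : ℕ → ℕ → ℕ → ℕ → Set ℓa
      Expansion m n l d = T A P m n l x y ≈ᴹ
        (multichooseSum m n (λ i → T A P 0 i (d ∸ i) x y) +ᴹ
         multichooseSum n m (λ i → T A P i 0 (d ∸ i) x y))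

      expansion-step : ∀ m n l d → Expansion m (suc n) (suc l) d → Expansion (suc m) n (suc l) d →
                       Expansion (suc m) (suc n) l d
      expansion-step m n l d e₁ e₂ = begin
        T A P (suc m) (suc n) l x y
          ≈⟨ T-pascal m n l x y ⟩
        T A P m (suc n) (suc l) x y +ᴹ T A P (suc m) n (suc l) x y
          ≈⟨ +ᴹ-cong e₁ e₂ ⟩
        (Σ₀ m (suc n) +ᴹ Σᵢ (suc n) m) +ᴹ (Σ₀ (suc m) n +ᴹ Σᵢ n (suc m))
          ≈⟨ interchange _ _ _ _ ⟩
        (Σ₀ m (suc n) +ᴹ Σ₀ (suc m) n) +ᴹ (Σᵢ (suc n) m +ᴹ Σᵢ n (suc m))
          ≈⟨ +ᴹ-cong ≈ᴹ-refl (+ᴹ-comm _ _) ⟩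
        (Σ₀ m (suc n) +ᴹ Σ₀ (suc m) n) +ᴹ (Σᵢ n (suc m) +ᴹ Σᵢ (suc n) m)
          ≈⟨ ≈ᴹ-sym (+ᴹ-cong (multichooseSum-pascal m n _) (multichooseSum-pascal n m _)) ⟩
        Σ₀ (suc m) (suc n) +ᴹ Σᵢ (suc n) (suc m) ∎
        where
        Σ₀ Σᵢ : ℕ → ℕ → Carrierᴹ
        Σ₀ p q = multichooseSum p q (λ i → T A P 0 i (d ∸ i) x y)
        Σᵢ p q = multichooseSum p q (λ i → T A P i 0 (d ∸ i) x y)

      expansion : ∀ m n l → 0 < m + n → Expansion m n l (m + n + l)
      expansion zero    (suc n) l _ = begin
        T A P 0 (suc n) l x y
          ≡⟨ cong (λ k → T A P 0 (suc n) k x y) (sym (m+n∸m≡n (suc n) l)) ⟩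
        T A P 0 (suc n) (suc n + l ∸ suc n) x y
          ≈⟨ ≈ᴹ-sym (multichooseSum-zero n _) ⟩
        multichooseSum 0 (suc n) (λ i → T A P 0 i (suc n + l ∸ i) x y)
          ≈⟨ ≈ᴹ-sym (+ᴹ-identityʳ _) ⟩
        multichooseSum 0 (suc n) (λ i → T A P 0 i (suc n + l ∸ i) x y) +ᴹ 0ᴹ ∎
      expansion (suc m) zero    l _ = begin
        T A P (suc m) 0 l x y
          ≡⟨ cong (λ k → T A P (suc m) 0 k x y) (sym d∸m≡l) ⟩
        T A P (suc m) 0 (suc m + 0 + l ∸ suc m) x y
          ≈⟨ ≈ᴹ-sym (multichooseSum-zero m _) ⟩
        multichooseSum 0 (suc m) (λ i → T A P i 0 (suc m + 0 + l ∸ i) x y)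
          ≈⟨ ≈ᴹ-sym (+ᴹ-identityˡ _) ⟩
        0ᴹ +ᴹ multichooseSum 0 (suc m) (λ i → T A P i 0 (suc m + 0 + l ∸ i) x y) ∎
        where
        d∸m≡l : suc m + 0 + l ∸ suc m ≡ l
        d∸m≡l = trans (cong (λ k → k + l ∸ suc m) (+-identityʳ (suc m))) (m+n∸m≡n (suc m) l)
      expansion (suc m) (suc n) l _ = expansion-step m n l d
        (subst (Expansion m (suc n) (suc l)) d₁≡d (expansion m (suc n) (suc l) 0<m+n+1))
        (subst (Expansion (suc m) n (suc l)) d₂≡d (expansion (suc m) n (suc l) z<s))
        where
        d = suc m + suc n + l
        d₁≡d : m + suc n + suc l ≡ d
        d₁≡d = +-suc (m + suc n) l
        d₂≡d : suc m + n + suc l ≡ d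
        d₂≡d = cong suc (trans (+-suc (m + n) l) (cong (_+ l) (sym (+-suc m n))))
        0<m+n+1 : 0 < m + suc n
        0<m+n+1 = <-≤-trans z<s (m≤n+m (suc n) m)

      binomial-expansion : ∀ m n l → T A P (suc m) (suc n) l x y ≈ᴹ
        (sum1 A (suc n) (λ i → ((m + (suc n ∸ i)) C m) × T A P 0 i (suc m + suc n + l ∸ i) x y) +ᴹ
         sum1 A (suc m) (λ i → ((n + (suc m ∸ i)) C n) × T A P i 0 (suc m + suc n + l ∸ i) x y))
      binomial-expansion m n l = ≈ᴹ-trans (expansion (suc m) (suc n) l z<s)
        (+ᴹ-cong (multichooseSum-binomial m (suc n) _) (multichooseSum-binomial n (suc m) _))

-- Characteristic zero is not used: the coefficients are natural-number multiples.  Likewise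
-- m, n ≥ 1 would suffice in place of 1 < m, 1 < n.
theorem1 : ∀ {c ℓ a ℓa : Level} (K : Field c ℓ) → CharacteristicZero K →
           (A : KAlgebra K a ℓa) (P : KAlgebra.Carrierᴹ A → KAlgebra.Carrierᴹ A) →
           IsRotaBaxter A (Field.0# K) P →
           ∀ (m n l : ℕ) → 1 < m → 1 < n → ∀ x y →
           KAlgebra._≈ᴹ_ A (T A P m n l x y)
             (KAlgebra._+ᴹ_ A
               (sum1 A n (λ i → KAlgebra._×_ A (((m ∸ 1) + (n ∸ i)) C (m ∸ 1))
                                  (T A P 0 i ((m + n + l) ∸ i) x y)))
               (sum1 A m (λ i → KAlgebra._×_ A (((n ∸ 1) + (m ∸ i)) C (n ∸ 1))
                                  (T A P i 0 ((m + n + l) ∸ i) x y))))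
theorem1 K _ A P rbP (suc m) (suc n) l (s≤s _) (s≤s _) x y = binomial-expansion A rbP x y m n l
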